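{- For any ground program $\Pi$ and atoms $a_1,a_2$ of $\Pi$, $\mathit{omit}(\mathit{omit}(\Pi,\{a_1\}),\{a_2\})=\mathit{omit}(\mathit{omit}(\Pi,\{a_2\}),\{a_1\})$.
   Context: Ground programs consist of rules $\alpha_0 \leftarrow \alpha_1,\dots,\alpha_m,\mathit{not}\ \alpha_{m+1},\dots,\mathit{not}\ \alpha_n$ with $\alpha_0$ an atom or $\bot$ (constraint), and possibly choice rules $\{\alpha\}\leftarrow B$. $H(r)$, $B^+(r)$, $B^-(r)$, $B^\pm(r)=B^+(r)\cup B^-(r)$ denote head, positive body, negative body, and all body atoms. For a set $A$ of atoms, $\mathit{omit}(r,A)$ is $r$ if $A\cap B^\pm(r)=\emptyset$ and $H(r)\notin A$; is the choice rule $\{H(r)\}\leftarrow B^+(r)\setminus A,\mathit{not}\ (B^-(r)\setminus A)$ if $A\cap B^\pm(r)\neq\emptyset$ and $H(r)\notin A\cup\{\bot\}$; and is no rule otherwise. For a choice rule $\{\alpha\}\leftarrow B$: kept if no body atom is in $A$ and $\alpha\notin A$; replaced by $\{\alpha\}\leftarrow B\setminus A$ (removing literals over $A$) if some body atom is in $A$ and $\alpha\notin A$; dropped otherwise. $\mathit{omit}(\Pi,A)=\bigcup_{r\in\Pi}\mathit{omit}(r,A)$. -}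

module Defs where

open import Data.Bool using (Bool; true; false)
import Data.Bool
open import Data.List using (List; []; _∷_; _++_; filter; concatMap)
open import Data.Bool.ListAction using (any)
open import Data.Maybe using (Maybe; just; nothing)
open import Relation.Nullary.Decidable using (does; ¬?)
open import Relation.Binary.Definitions using (DecidableEquality)

-- Ground rules over an arbitrary type of atoms.
--   normal h B⁺ B⁻ :  h ← B⁺, not B⁻   where h = just α (atom head) or nothing (⊥, a constraint)
--   choice α B⁺ B⁻ :  {α} ← B⁺, not B⁻
data Rule (Atom : Set) : Set where
  normal : Maybe Atom → List Atom → List Atom → Rule Atom
  choice : Atom → List Atom → List Atom → Rule Atom

-- A ground program is a (finite) collection of rules; programs are compared
-- as sets (set equality of lists), see Statement.
Program : Set → Set
Program Atom = List (Rule Atom)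

module _ {Atom : Set} (_≟_ : DecidableEquality Atom) where

  _∈ᵇ_ : Atom → List Atom → Bool
  x ∈ᵇ A = any (λ y → does (x ≟ y)) A

  meets : List Atom → List Atom → Bool
  meets A B = any (λ b → b ∈ᵇ A) B

  minus : List Atom → List Atom → List Atom
  minus B A = filter (λ b → ¬? (Data.Bool._≟_ (b ∈ᵇ A) true)) B

  headIn : Maybe Atom → List Atom → Bool
  headIn nothing  A = false
  headIn (just x) A = x ∈ᵇ A

  omitRule : List Atom → Rule Atom → List (Rule Atom)
  omitRule A (normal h p n) with meets A (p ++ n) | headIn h A | h
  ... | false | false | _       = normal h p n ∷ []
  ... | true  | false | just x  = choice x (minus p A) (minus n A) ∷ []
  ... | true  | false | nothing = []
  ... | _     | true  | _       = []
  omitRule A (choice x p n) with meets A (p ++ n) | x ∈ᵇ A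
  ... | false | false = choice x p n ∷ []
  ... | true  | false = choice x (minus p A) (minus n A) ∷ []
  ... | _     | true  = []

  omit : Program Atom → List Atom → Program Atom
  omit Π A = concatMap (omitRule A) Π

ruleAtoms : ∀ {Atom} → Rule Atom → List Atom
ruleAtoms (normal nothing  p n) = p ++ n
ruleAtoms (normal (just x) p n) = x ∷ p ++ n
ruleAtoms (choice x p n)        = x ∷ p ++ n

atoms : ∀ {Atom} → Program Atom → List Atom
atoms Π = concatMap ruleAtoms Π

module Submission where

-- Atom sets are lists and A ∪ B is A ++ B.  We prove two facts for
-- arbitrary atom sets A, B:
--   composition    omit (omit Π A) B ≡ omit Π (A ++ B),
--   extensionality omit Π A ≡ omit Π B whenever A and B have the same members.
-- Since A ++ B and B ++ A have the same members, omitting A then B and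
-- omitting B then A give syntactically equal programs.

open import Defs
open import Data.Bool using (Bool; true; false; _∨_; if_then_else_) renaming (_≟_ to _≟ᵇ_)
open import Data.Bool.ListAction using (any)
open import Data.Bool.Properties using (∨-assoc; ∨-comm)
open import Data.List using (List; []; _∷_; _++_)
open import Data.List.Properties
  using (concatMap-++; concatMap-cong; ++-identityʳ; filter-accept; filter-reject)
open import Data.List.Membership.Propositional using (_∈_)
open import Data.List.Relation.Binary.BagAndSetEquality using (_∼[_]_; set)
open import Data.Maybe using (Maybe; just; nothing)
open import Data.Product using (_×_; _,_)
open import Data.Empty using (⊥)
open import Function.Related.Propositional using (K-refl)
open import Relation.Binary.Definitions using (DecidableEquality)
open import Relation.Binary.PropositionalEquality
  using (_≡_; refl; sym; trans; cong; cong₂; module ≡-Reasoning)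
open import Relation.Nullary.Decidable using (¬?)

∨-false : ∀ {x y} → x ∨ y ≡ false → x ≡ false × y ≡ false
∨-false {false} {false} refl = refl , refl

false≢true : false ≡ true → ⊥
false≢true ()

module _ {A : Set} where

  any-++ : ∀ (f : A → Bool) xs ys → any f (xs ++ ys) ≡ any f xs ∨ any f ys
  any-++ f []       ys = refl
  any-++ f (x ∷ xs) ys rewrite any-++ f xs ys = sym (∨-assoc (f x) (any f xs) (any f ys))

  any-∨ : ∀ (f g : A → Bool) xs → any (λ x → f x ∨ g x) xs ≡ any f xs ∨ any g xs
  any-∨ f g []       = refl
  any-∨ f g (x ∷ xs) rewrite any-∨ f g xs with f x | g x
  ... | true  | _     = refl
  ... | false | true  = sym (∨-comm (any f xs) true)
  ... | false | false = refl

  any-cong : ∀ {f g : A → Bool} → (∀ x → f x ≡ g x) → ∀ xs → any f xs ≡ any g xs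
  any-cong f≗g []       = refl
  any-cong f≗g (x ∷ xs) = cong₂ _∨_ (f≗g x) (any-cong f≗g xs)

module _ {Atom : Set} (_≟_ : DecidableEquality Atom) where

  open ≡-Reasoning

  _∈?_ : Atom → List Atom → Bool
  _∈?_ = _∈ᵇ_ _≟_

  _≋_ : List Atom → List Atom → Set
  A ≋ B = ∀ x → x ∈? A ≡ x ∈? B

  ∈-++ : ∀ x A B → x ∈? (A ++ B) ≡ x ∈? A ∨ x ∈? B
  ∈-++ x A B = any-++ _ A B

  ++-comm-≋ : ∀ A B → (A ++ B) ≋ (B ++ A)
  ++-comm-≋ A B x = trans (∈-++ x A B) (trans (∨-comm (x ∈? A) (x ∈? B)) (sym (∈-++ x B A)))

  meets-++ : ∀ A B xs → meets _≟_ (A ++ B) xs ≡ meets _≟_ A xs ∨ meets _≟_ B xs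
  meets-++ A B xs = trans (any-cong (λ x → ∈-++ x A B) xs) (any-∨ _ _ xs)

  meets-cong : ∀ A B → A ≋ B → ∀ xs → meets _≟_ A xs ≡ meets _≟_ B xs
  meets-cong A B A≋B = any-cong A≋B

  meets-body : ∀ A p n → meets _≟_ A (p ++ n) ≡ meets _≟_ A p ∨ meets _≟_ A n
  meets-body A p n = any-++ _ p n

  body-disjoint : ∀ A p n → meets _≟_ A (p ++ n) ≡ false →
                  meets _≟_ A p ≡ false × meets _≟_ A n ≡ false
  body-disjoint A p n disj = ∨-false (trans (sym (meets-body A p n)) disj)

  headIn-++ : ∀ h A B → headIn _≟_ h (A ++ B) ≡ headIn _≟_ h A ∨ headIn _≟_ h B
  headIn-++ nothing  A B = refl
  headIn-++ (just x) A B = ∈-++ x A B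

  headIn-cong : ∀ A B → A ≋ B → ∀ h → headIn _≟_ h A ≡ headIn _≟_ h B
  headIn-cong A B A≋B nothing  = refl
  headIn-cong A B A≋B (just x) = A≋B x

  minus-keep : ∀ {x} A xs → x ∈? A ≡ false → minus _≟_ (x ∷ xs) A ≡ x ∷ minus _≟_ xs A
  minus-keep A xs x∉A =
    filter-accept (λ b → ¬? (b ∈? A ≟ᵇ true)) λ x∈A → false≢true (trans (sym x∉A) x∈A)

  minus-drop : ∀ {x} A xs → x ∈? A ≡ true → minus _≟_ (x ∷ xs) A ≡ minus _≟_ xs A
  minus-drop A xs x∈A = filter-reject (λ b → ¬? (b ∈? A ≟ᵇ true)) λ x∉A → x∉A x∈A

  minus-++ : ∀ A B xs → minus _≟_ xs (A ++ B) ≡ minus _≟_ (minus _≟_ xs A) B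
  minus-++ A B []       = refl
  minus-++ A B (x ∷ xs) = by-membership (x ∈? A) (x ∈? B) refl refl
    where
    goal : Set
    goal = minus _≟_ (x ∷ xs) (A ++ B) ≡ minus _≟_ (minus _≟_ (x ∷ xs) A) B

    in-union : ∀ {a b} → x ∈? A ≡ a → x ∈? B ≡ b → x ∈? (A ++ B) ≡ a ∨ b
    in-union x∈A x∈B = trans (∈-++ x A B) (cong₂ _∨_ x∈A x∈B)

    by-membership : ∀ a b → x ∈? A ≡ a → x ∈? B ≡ b → goal
    by-membership true _ x∈A x∈B = begin
      minus _≟_ (x ∷ xs) (A ++ B)         ≡⟨ minus-drop (A ++ B) xs (in-union x∈A x∈B) ⟩
      minus _≟_ xs (A ++ B)               ≡⟨ minus-++ A B xs ⟩
      minus _≟_ (minus _≟_ xs A) B        ≡⟨ cong (λ ys → minus _≟_ ys B) (minus-drop A xs x∈A) ⟨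
      minus _≟_ (minus _≟_ (x ∷ xs) A) B  ∎
    by-membership false true x∈A x∈B = begin
      minus _≟_ (x ∷ xs) (A ++ B)         ≡⟨ minus-drop (A ++ B) xs (in-union x∈A x∈B) ⟩
      minus _≟_ xs (A ++ B)               ≡⟨ minus-++ A B xs ⟩
      minus _≟_ (minus _≟_ xs A) B        ≡⟨ minus-drop B _ x∈B ⟨
      minus _≟_ (x ∷ minus _≟_ xs A) B    ≡⟨ cong (λ ys → minus _≟_ ys B) (minus-keep A xs x∈A) ⟨
      minus _≟_ (minus _≟_ (x ∷ xs) A) B  ∎
    by-membership false false x∈A x∈B = begin
      minus _≟_ (x ∷ xs) (A ++ B)         ≡⟨ minus-keep (A ++ B) xs (in-union x∈A x∈B) ⟩
      x ∷ minus _≟_ xs (A ++ B)           ≡⟨ cong (x ∷_) (minus-++ A B xs) ⟩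
      x ∷ minus _≟_ (minus _≟_ xs A) B    ≡⟨ minus-keep B _ x∈B ⟨
      minus _≟_ (x ∷ minus _≟_ xs A) B    ≡⟨ cong (λ ys → minus _≟_ ys B) (minus-keep A xs x∈A) ⟨
      minus _≟_ (minus _≟_ (x ∷ xs) A) B  ∎

  minus-disjoint : ∀ A xs → meets _≟_ A xs ≡ false → minus _≟_ xs A ≡ xs
  minus-disjoint A []       _    = refl
  minus-disjoint A (x ∷ xs) disj with x∉A , disj′ ← ∨-false {x ∈? A} disj =
    trans (minus-keep A xs x∉A) (cong (x ∷_) (minus-disjoint A xs disj′))

  minus-++-disjoint : ∀ A B xs → meets _≟_ A xs ≡ false → minus _≟_ xs (A ++ B) ≡ minus _≟_ xs B
  minus-++-disjoint A B xs disj =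
    trans (minus-++ A B xs) (cong (λ ys → minus _≟_ ys B) (minus-disjoint A xs disj))

  minus-cong : ∀ A B → A ≋ B → ∀ xs → minus _≟_ xs A ≡ minus _≟_ xs B
  minus-cong A B A≋B []       = refl
  minus-cong A B A≋B (x ∷ xs) = by-membership (x ∈? B) refl
    where
    by-membership : ∀ b → x ∈? B ≡ b → minus _≟_ (x ∷ xs) A ≡ minus _≟_ (x ∷ xs) B
    by-membership true x∈B = begin
      minus _≟_ (x ∷ xs) A      ≡⟨ minus-drop A xs (trans (A≋B x) x∈B) ⟩
      minus _≟_ xs A            ≡⟨ minus-cong A B A≋B xs ⟩
      minus _≟_ xs B            ≡⟨ minus-drop B xs x∈B ⟨
      minus _≟_ (x ∷ xs) B      ∎
    by-membership false x∈B = begin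
      minus _≟_ (x ∷ xs) A      ≡⟨ minus-keep A xs (trans (A≋B x) x∈B) ⟩
      x ∷ minus _≟_ xs A        ≡⟨ cong (x ∷_) (minus-cong A B A≋B xs) ⟩
      x ∷ minus _≟_ xs B        ≡⟨ minus-keep B xs x∈B ⟨
      minus _≟_ (x ∷ xs) B      ∎

  relax : Maybe Atom → List Atom → List Atom → Program Atom
  relax nothing  p n = []
  relax (just x) p n = choice x p n ∷ []

  -- The common shape of omit(r, A) for choice rules and for normal rules
  -- whose body meets A: dropped if the head is in A, otherwise relaxed with
  -- A removed from the body.
  prune : List Atom → Maybe Atom → List Atom → List Atom → Program Atom
  prune A h p n = if headIn _≟_ h A then [] else relax h (minus _≟_ p A) (minus _≟_ n A)

  omit-head-in : ∀ A h p n → headIn _≟_ h A ≡ true → omitRule _≟_ A (normal h p n) ≡ []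
  omit-head-in A h p n h∈A rewrite h∈A with meets _≟_ A (p ++ n)
  ... | false = refl
  ... | true  = refl

  omit-untouched : ∀ A h p n → meets _≟_ A (p ++ n) ≡ false → headIn _≟_ h A ≡ false →
                   omitRule _≟_ A (normal h p n) ≡ normal h p n ∷ []
  omit-untouched A h p n disj h∉A rewrite disj | h∉A = refl

  omit-touched : ∀ A h p n → meets _≟_ A (p ++ n) ≡ true →
                 omitRule _≟_ A (normal h p n) ≡ prune A h p n
  omit-touched A nothing  p n touch rewrite touch = refl
  omit-touched A (just x) p n touch rewrite touch with x ∈? A
  ... | true  = refl
  ... | false = refl

  -- For a choice rule the two non-dropping branches agree, since removing a
  -- disjoint set from the body changes nothing.
  omit-choice : ∀ A x p n → omitRule _≟_ A (choice x p n) ≡ prune A (just x) p n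
  omit-choice A x p n with meets _≟_ A (p ++ n) in m | x ∈? A
  ... | true  | true  = refl
  ... | true  | false = refl
  ... | false | true  = refl
  ... | false | false with p-disj , n-disj ← body-disjoint A p n m
    rewrite minus-disjoint A p p-disj | minus-disjoint A n n-disj = refl

  omitNormal-ext : ∀ A B h p n →
    headIn _≟_ h A ≡ headIn _≟_ h B → meets _≟_ A (p ++ n) ≡ meets _≟_ B (p ++ n) →
    minus _≟_ p A ≡ minus _≟_ p B → minus _≟_ n A ≡ minus _≟_ n B →
    omitRule _≟_ A (normal h p n) ≡ omitRule _≟_ B (normal h p n)
  omitNormal-ext A B nothing p n _ same-meets _ _ rewrite same-meets with meets _≟_ B (p ++ n)
  ... | false = refl
  ... | true  = refl
  omitNormal-ext A B (just x) p n same-head same-meets same-p same-n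
    rewrite same-head | same-meets with meets _≟_ B (p ++ n) | x ∈? B
  ... | false | false = refl
  ... | false | true  = refl
  ... | true  | false rewrite same-p | same-n = refl
  ... | true  | true  = refl

  omit-singleton : ∀ B r → omit _≟_ (r ∷ []) B ≡ omitRule _≟_ B r
  omit-singleton B r = ++-identityʳ (omitRule _≟_ B r)

  prune-prune : ∀ A B h p n → omit _≟_ (prune A h p n) B ≡ prune (A ++ B) h p n
  prune-prune A B nothing  p n = refl
  prune-prune A B (just x) p n rewrite ∈-++ x A B with x ∈? A
  ... | true  = refl
  ... | false rewrite minus-++ A B p | minus-++ A B n =
    trans (omit-singleton B (choice x _ _)) (omit-choice B x _ _)

  omit-irrelevant : ∀ A B h p n → meets _≟_ A (p ++ n) ≡ false → headIn _≟_ h A ≡ false →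
                    omitRule _≟_ (A ++ B) (normal h p n) ≡ omitRule _≟_ B (normal h p n)
  omit-irrelevant A B h p n disj h∉A with p-disj , n-disj ← body-disjoint A p n disj =
    omitNormal-ext (A ++ B) B h p n
      (trans (headIn-++ h A B) (cong (_∨ _) h∉A))
      (trans (meets-++ A B (p ++ n)) (cong (_∨ _) disj))
      (minus-++-disjoint A B p p-disj)
      (minus-++-disjoint A B n n-disj)

  omitRule-compose : ∀ A B r → omit _≟_ (omitRule _≟_ A r) B ≡ omitRule _≟_ (A ++ B) r
  omitRule-compose A B (choice x p n) = begin
    omit _≟_ (omitRule _≟_ A (choice x p n)) B  ≡⟨ cong (λ Δ → omit _≟_ Δ B) (omit-choice A x p n) ⟩
    omit _≟_ (prune A (just x) p n) B           ≡⟨ prune-prune A B (just x) p n ⟩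
    prune (A ++ B) (just x) p n                 ≡⟨ omit-choice (A ++ B) x p n ⟨
    omitRule _≟_ (A ++ B) (choice x p n)        ∎
  omitRule-compose A B (normal h p n) =
    by-observation (meets _≟_ A (p ++ n)) (headIn _≟_ h A) refl refl
    where
    r : Rule Atom
    r = normal h p n

    by-observation : ∀ m k → meets _≟_ A (p ++ n) ≡ m → headIn _≟_ h A ≡ k →
                     omit _≟_ (omitRule _≟_ A r) B ≡ omitRule _≟_ (A ++ B) r
    by-observation true _ touch _ = begin
      omit _≟_ (omitRule _≟_ A r) B  ≡⟨ cong (λ Δ → omit _≟_ Δ B) (omit-touched A h p n touch) ⟩
      omit _≟_ (prune A h p n) B     ≡⟨ prune-prune A B h p n ⟩
      prune (A ++ B) h p n           ≡⟨ omit-touched (A ++ B) h p n union-touches ⟨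
      omitRule _≟_ (A ++ B) r        ∎
      where
      union-touches : meets _≟_ (A ++ B) (p ++ n) ≡ true
      union-touches = trans (meets-++ A B (p ++ n)) (cong (_∨ _) touch)
    by-observation false true _ h∈A = begin
      omit _≟_ (omitRule _≟_ A r) B  ≡⟨ cong (λ Δ → omit _≟_ Δ B) (omit-head-in A h p n h∈A) ⟩
      []                             ≡⟨ omit-head-in (A ++ B) h p n h∈A∪B ⟨
      omitRule _≟_ (A ++ B) r        ∎
      where
      h∈A∪B : headIn _≟_ h (A ++ B) ≡ true
      h∈A∪B = trans (headIn-++ h A B) (cong (_∨ _) h∈A)
    by-observation false false disj h∉A = begin
      omit _≟_ (omitRule _≟_ A r) B  ≡⟨ cong (λ Δ → omit _≟_ Δ B) (omit-untouched A h p n disj h∉A) ⟩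
      omit _≟_ (r ∷ []) B            ≡⟨ omit-singleton B r ⟩
      omitRule _≟_ B r               ≡⟨ omit-irrelevant A B h p n disj h∉A ⟨
      omitRule _≟_ (A ++ B) r        ∎

  prune-cong : ∀ A B → A ≋ B → ∀ h p n → prune A h p n ≡ prune B h p n
  prune-cong A B A≋B h p n
    rewrite headIn-cong A B A≋B h | minus-cong A B A≋B p | minus-cong A B A≋B n = refl

  omitRule-cong : ∀ A B → A ≋ B → ∀ r → omitRule _≟_ A r ≡ omitRule _≟_ B r
  omitRule-cong A B A≋B (normal h p n) =
    omitNormal-ext A B h p n (headIn-cong A B A≋B h) (meets-cong A B A≋B (p ++ n))
                             (minus-cong A B A≋B p) (minus-cong A B A≋B n)
  omitRule-cong A B A≋B (choice x p n) = begin
    omitRule _≟_ A (choice x p n)  ≡⟨ omit-choice A x p n ⟩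
    prune A (just x) p n           ≡⟨ prune-cong A B A≋B (just x) p n ⟩
    prune B (just x) p n           ≡⟨ omit-choice B x p n ⟨
    omitRule _≟_ B (choice x p n)  ∎

  omit-compose : ∀ A B Π → omit _≟_ (omit _≟_ Π A) B ≡ omit _≟_ Π (A ++ B)
  omit-compose A B []      = refl
  omit-compose A B (r ∷ Π) = begin
    omit _≟_ (omitRule _≟_ A r ++ omit _≟_ Π A) B
      ≡⟨ concatMap-++ (omitRule _≟_ B) (omitRule _≟_ A r) (omit _≟_ Π A) ⟩
    omit _≟_ (omitRule _≟_ A r) B ++ omit _≟_ (omit _≟_ Π A) B
      ≡⟨ cong₂ _++_ (omitRule-compose A B r) (omit-compose A B Π) ⟩
    omitRule _≟_ (A ++ B) r ++ omit _≟_ Π (A ++ B)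
      ∎

  omit-cong : ∀ A B → A ≋ B → ∀ Π → omit _≟_ Π A ≡ omit _≟_ Π B
  omit-cong A B A≋B = concatMap-cong (omitRule-cong A B A≋B)

  omit-comm : ∀ A B Π → omit _≟_ (omit _≟_ Π A) B ≡ omit _≟_ (omit _≟_ Π B) A
  omit-comm A B Π = begin
    omit _≟_ (omit _≟_ Π A) B  ≡⟨ omit-compose A B Π ⟩
    omit _≟_ Π (A ++ B)        ≡⟨ omit-cong (A ++ B) (B ++ A) (++-comm-≋ A B) Π ⟩
    omit _≟_ Π (B ++ A)        ≡⟨ omit-compose B A Π ⟨
    omit _≟_ (omit _≟_ Π B) A  ∎

-- Lemma 4: omit(omit(Π, {a₁}), {a₂}) = omit(omit(Π, {a₂}), {a₁}).  The two
-- programs are even syntactically equal.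
lemma4 : {Atom : Set} (_≟_ : DecidableEquality Atom) (Π : Program Atom) (a₁ a₂ : Atom) →
    a₁ ∈ atoms Π → a₂ ∈ atoms Π →
    omit _≟_ (omit _≟_ Π (a₁ ∷ [])) (a₂ ∷ []) ∼[ set ] omit _≟_ (omit _≟_ Π (a₂ ∷ [])) (a₁ ∷ [])
lemma4 _≟_ Π a₁ a₂ _ _ rewrite omit-comm _≟_ (a₁ ∷ []) (a₂ ∷ []) Π = K-refl
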